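{- Let $v\in\{a,b\}^*$ be non-constant (i.e. containing both letters) and $w=a\psi(v)b$. Then $\partial w=a\psi({}_+v)b$.
   Context: Alphabet $\mathcal A=\{a,b\}$. The right palindromic closure $u^{(+)}$ of $u$ is the shortest palindrome having prefix $u$. The palindromization map $\psi$: $\psi(\varepsilon)=\varepsilon$, $\psi(ux)=(\psi(u)x)^{(+)}$ ($u\in\mathcal A^*,x\in\mathcal A$). Proper Christoffel words are the words $a\psi(v)b$, $v\in\mathcal A^*$. Write a nonempty $v$ uniquely as $x_0^{\alpha_0}\cdots x_n^{\alpha_n}$ with $\alpha_i\ge1$, $x_{i+1}\ne x_i$; the index of $a\psi(v)b$ is $0$ if $v=\varepsilon$ and $\alpha_0$ otherwise. For $k\ge0$, $\varphi_k:a\mapsto a^{k+1}b,\ b\mapsto a^kb$ and $\hat\varphi_k:a\mapsto ab^k,\ b\mapsto ab^{k+1}$. The derivative of a proper Christoffel word $w=a\psi(v)b$ of index $k$ is: $\partial ab=a$ if $k=0$; $\partial w=\varphi_k^{ -1}(w)$ if $k>0$ and $v$ begins with $a$; $\partial w=\hat\varphi_k^{ -1}(w)$ if $k>0$ and $v$ begins with $b$ (in these cases $w$ lies in $\varphi_k(\mathcal A^*)$, resp. $\hat\varphi_k(\mathcal A^*)$, and the morphisms are injective). For a non-constant word $v$, ${}_+v$ denotes the longest suffix of $v$ which is immediately preceded by the letter different from the first letter of $v$. -}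

module Defs where

open import Data.Nat using (ℕ; zero; suc; _≡ᵇ_)
open import Data.Bool using (Bool; true; false; if_then_else_)
open import Data.List using (List; []; _∷_; _++_; [_]; reverse; take; length; foldl)
open import Data.Maybe using (Maybe; just; nothing)
import Data.Maybe as Maybe
open import Data.List.Membership.Propositional using (_∈_)
open import Data.Product using (_×_)

data Letter : Set where
  a b : Letter

Word : Set
Word = List Letter

_==_ : Letter → Letter → Bool
a == a = true
b == b = true
_ == _ = false

compl : Letter → Letter
compl a = b
compl b = a

_==w_ : Word → Word → Bool
[] ==w [] = true
(x ∷ u) ==w (y ∷ v) = if x == y then u ==w v else false
_ ==w _ = false

isPal : Word → Bool
isPal u = reverse u ==w u

-- Right palindromic closure: the shortest palindrome having prefix u.
-- Any palindrome of length |u|+k (k ≤ |u|) with prefix u is exactly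
-- u ++ reverse (take k u); we search k = 0,1,...,|u| in increasing order
-- (k = |u| always yields a palindrome, used as the fuel-exhausted fallback).
closureSearch : Word → ℕ → ℕ → Word
closureSearch u k zero = u ++ reverse u
closureSearch u k (suc fuel) =
  if isPal (u ++ reverse (take k u)) then u ++ reverse (take k u)
  else closureSearch u (suc k) fuel

rclosure : Word → Word
rclosure u = closureSearch u 0 (suc (length u))

ψ : Word → Word
ψ v = foldl (λ p x → rclosure (p ++ [ x ])) [] v

christoffel : Word → Word
christoffel v = a ∷ (ψ v ++ [ b ])

rep : ℕ → Letter → Word
rep zero x = []
rep (suc n) x = x ∷ rep n x

φ : ℕ → Word → Word
φ k [] = []
φ k (a ∷ u) = rep (suc k) a ++ (b ∷ φ k u)
φ k (b ∷ u) = rep k a ++ (b ∷ φ k u)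

φ̂ : ℕ → Word → Word
φ̂ k [] = []
φ̂ k (a ∷ u) = a ∷ (rep k b ++ φ̂ k u)
φ̂ k (b ∷ u) = a ∷ (rep (suc k) b ++ φ̂ k u)

-- φ_k^{-1} : decoding (nothing if the word is not in φ_k(A*)).
-- n = number of a's read since the last codeword boundary
decφ-go : ℕ → ℕ → Word → Maybe Word
decφ-go k zero [] = just []
decφ-go k (suc n) [] = nothing
decφ-go k n (a ∷ w) = decφ-go k (suc n) w
decφ-go k n (b ∷ w) =
  if n ≡ᵇ suc k then Maybe.map (a ∷_) (decφ-go k 0 w)
  else if n ≡ᵇ k then Maybe.map (b ∷_) (decφ-go k 0 w)
  else nothing

φ⁻¹ : ℕ → Word → Maybe Word
φ⁻¹ k w = decφ-go k 0 w

-- φ̂_k^{-1} : decoding (nothing if the word is not in φ̂_k(A*)).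
-- state nothing: at a codeword boundary; just m: inside a codeword a b^m
emitφ̂ : ℕ → ℕ → Maybe Word → Maybe Word
emitφ̂ k m r =
  if m ≡ᵇ k then Maybe.map (a ∷_) r
  else if m ≡ᵇ suc k then Maybe.map (b ∷_) r
  else nothing

decφ̂-go : ℕ → Maybe ℕ → Word → Maybe Word
decφ̂-go k nothing [] = just []
decφ̂-go k nothing (a ∷ w) = decφ̂-go k (just 0) w
decφ̂-go k nothing (b ∷ w) = nothing
decφ̂-go k (just m) [] = emitφ̂ k m (just [])
decφ̂-go k (just m) (b ∷ w) = decφ̂-go k (just (suc m)) w
decφ̂-go k (just m) (a ∷ w) = emitφ̂ k m (decφ̂-go k (just 0) w)

φ̂⁻¹ : ℕ → Word → Maybe Word
φ̂⁻¹ k w = decφ̂-go k nothing w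

runLength : Letter → Word → ℕ
runLength x [] = zero
runLength x (y ∷ u) = if x == y then suc (runLength x u) else zero

-- index of a ψ(v) b : 0 if v = ε, α₀ otherwise
index : Word → ℕ
index [] = zero
index (x ∷ u) = runLength x (x ∷ u)

-- derivative ∂ (a ψ(v) b), as a function of v (v is determined by w).
-- Returns nothing only if the relevant preimage does not exist.
∂ : Word → Maybe Word
∂ [] = just [ a ]
∂ (a ∷ u) = φ⁻¹ (index (a ∷ u)) (christoffel (a ∷ u))
∂ (b ∷ u) = φ̂⁻¹ (index (b ∷ u)) (christoffel (b ∷ u))

afterFirst : Letter → Word → Word
afterFirst c [] = []
afterFirst c (y ∷ u) = if y == c then u else afterFirst c u

-- ₊v : longest suffix of v immediately preceded by the letter different
-- from the first letter of v (meaningful for non-constant v)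
₊_ : Word → Word
₊ [] = []
₊ (x ∷ u) = afterFirst (compl x) u

NonConstant : Word → Set
NonConstant v = (a ∈ v) × (b ∈ v)

-- Right palindromic closure commutes with Justin's morphism μₓ (x ↦ x, compl x ↦ x compl x):
-- if s is the longest palindromic suffix of w, then μₓ(s) x is that of μₓ(w) x and, when w ends
-- with compl x, μₓ(s) without its first letter is that of μₓ(w). This gives Justin's formula
-- ψ(x u) = μₓ(ψ u) x, hence a ψ(a v) b = φ̂₀(a ψ(v) b) and a ψ(b v) b = φ₀(a ψ(v) b).
-- As φₖ₊₁ = φ̂₀ ∘ φₖ and φ̂ₖ₊₁ = φ₀ ∘ φ̂ₖ, a word v = aᵏ b u of index k satisfies
-- a ψ(v) b = φₖ(a ψ(u) b) with u = ₊v (symmetrically for b), and decoding by φₖ⁻¹ gives ∂.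

module Submission where

open import Defs
open import Data.Bool using (true; false; if_then_else_)
open import Data.Empty using (⊥-elim)
open import Data.List using ([]; _∷_; _++_; _∷ʳ_; [_]; reverse; take; drop; length; foldl)
open import Data.List.Base using (initLast; _∷ʳ′_)
open import Data.List.Properties
  using (++-assoc; ++-identityʳ; ++-cancelˡ; ++-cancelʳ; reverse-++; reverse-involutive;
         ∷-injectiveˡ; ∷-injectiveʳ; ∷ʳ-injective; ∷ʳ-injectiveˡ; ∷ʳ-injectiveʳ; unfold-reverse;
         take++drop≡id; length-take; length-++; length-++-≤ˡ)
open import Data.Nat using (zero; suc; _+_; _≤_; _<_; _⊓_; s≤s; _≡ᵇ_)
open import Data.Maybe using (just; nothing)
import Data.Maybe as Maybe
open import Data.List.Membership.Propositional using (_∈_)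
open import Data.List.Relation.Unary.Any using (here; there)
open import Function using (_∘_)
open import Data.Nat.Properties using (+-identityʳ; +-suc; m≤m+n; m⊓n≤m; <⇒≱; module ≤-Reasoning)
open import Data.Product using (∃; ∃₂; _,_)
open import Relation.Binary.PropositionalEquality hiding ([_])
open import Relation.Nullary using (¬_)

Palindrome : Word → Set
Palindrome u = reverse u ≡ u

==w⇒≡ : ∀ u v → (u ==w v) ≡ true → u ≡ v
==w⇒≡ []      []      _ = refl
==w⇒≡ (a ∷ u) (a ∷ v) e = cong (a ∷_) (==w⇒≡ u v e)
==w⇒≡ (b ∷ u) (b ∷ v) e = cong (b ∷_) (==w⇒≡ u v e)

==w-refl : ∀ u → (u ==w u) ≡ true
==w-refl []      = refl
==w-refl (a ∷ u) = ==w-refl u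
==w-refl (b ∷ u) = ==w-refl u

isPal⇒Palindrome : ∀ u → isPal u ≡ true → Palindrome u
isPal⇒Palindrome u = ==w⇒≡ (reverse u) u

Palindrome⇒isPal : ∀ {u} → Palindrome u → isPal u ≡ true
Palindrome⇒isPal {u} p = subst (λ r → (r ==w u) ≡ true) (sym p) (==w-refl u)

reverse-sandwich : ∀ (t s : Word) → reverse (t ++ s ++ reverse t) ≡ t ++ reverse s ++ reverse t
reverse-sandwich t s = begin
  reverse (t ++ s ++ reverse t)          ≡⟨ reverse-++ t (s ++ reverse t) ⟩
  reverse (s ++ reverse t) ++ reverse t  ≡⟨ cong (_++ reverse t) (reverse-++ s (reverse t)) ⟩
  (reverse (reverse t) ++ reverse s) ++ reverse t
    ≡⟨ cong (λ q → (q ++ reverse s) ++ reverse t) (reverse-involutive t) ⟩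
  (t ++ reverse s) ++ reverse t          ≡⟨ ++-assoc t (reverse s) (reverse t) ⟩
  t ++ reverse s ++ reverse t            ∎
  where open ≡-Reasoning

sandwich-palindrome : ∀ (t : Word) {s} → Palindrome s → Palindrome (t ++ s ++ reverse t)
sandwich-palindrome t {s} p = trans (reverse-sandwich t s) (cong (λ q → t ++ q ++ reverse t) p)

sandwich-palindrome⁻ : ∀ (t : Word) {s} → Palindrome (t ++ s ++ reverse t) → Palindrome s
sandwich-palindrome⁻ t {s} p =
  ++-cancelʳ (reverse t) (reverse s) s (++-cancelˡ t _ _ (trans (sym (reverse-sandwich t s)) p))

palindrome-∷ʳ : ∀ B {z} → Palindrome (B ∷ʳ z) → ∃ λ S → B ∷ʳ z ≡ z ∷ S
palindrome-∷ʳ B {z} p = reverse B , trans (sym p) (reverse-++ B [ z ])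

take-length-++ : ∀ (t s : Word) → take (length t) (t ++ s) ≡ t
take-length-++ []      s = refl
take-length-++ (x ∷ t) s = cong (x ∷_) (take-length-++ t s)

drop-length-++ : ∀ (t s : Word) → drop (length t) (t ++ s) ≡ s
drop-length-++ []      s = refl
drop-length-++ (x ∷ t) s = drop-length-++ t s

candidate-sandwich : ∀ j (u : Word) → u ++ reverse (take j u) ≡ take j u ++ drop j u ++ reverse (take j u)
candidate-sandwich j u =
  trans (cong (_++ reverse (take j u)) (sym (take++drop≡id j u))) (++-assoc (take j u) (drop j u) _)

candidate-palindrome : ∀ j u → Palindrome (drop j u) → Palindrome (u ++ reverse (take j u))
candidate-palindrome j u p = subst Palindrome (sym (candidate-sandwich j u)) (sandwich-palindrome (take j u) p)

candidate-palindrome⁻ : ∀ j u → Palindrome (u ++ reverse (take j u)) → Palindrome (drop j u)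
candidate-palindrome⁻ j u p = sandwich-palindrome⁻ (take j u) (subst Palindrome (candidate-sandwich j u) p)

record LongestPalSuffix (u t s : Word) : Set where
  field
    split      : u ≡ t ++ s
    palindrome : Palindrome s
    shortest   : ∀ {t' s'} → u ≡ t' ++ s' → Palindrome s' → ∃ λ r → t' ≡ t ++ r
open LongestPalSuffix

longestPalSuffix : ∀ u → ∃₂ (LongestPalSuffix u)
longestPalSuffix [] = [] , [] , record { split = refl ; palindrome = refl ; shortest = λ _ _ → _ , refl }
longestPalSuffix (x ∷ u) with isPal (x ∷ u) in isPal-x∷u
... | true = [] , x ∷ u , record
  { split = refl ; palindrome = isPal⇒Palindrome (x ∷ u) isPal-x∷u ; shortest = λ _ _ → _ , refl }
... | false with longestPalSuffix u
... | t , s , L = x ∷ t , s , record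
  { split = cong (x ∷_) (split L) ; palindrome = palindrome L ; shortest = shortest-x∷ }
  where
    shortest-x∷ : ∀ {t' s'} → x ∷ u ≡ t' ++ s' → Palindrome s' → ∃ λ r → t' ≡ (x ∷ t) ++ r
    shortest-x∷ {[]} refl p with () ← trans (sym isPal-x∷u) (Palindrome⇒isPal p)
    shortest-x∷ {y ∷ t'} e p with refl ← ∷-injectiveˡ e with r , refl ← shortest L {t'} (∷-injectiveʳ e) p =
      r , refl

longestPalSuffix-minimal : ∀ {u t s} → LongestPalSuffix u t s → ∀ i → Palindrome (drop i u) → length t ≤ i
longestPalSuffix-minimal {u} {t} L i p with r , e ← shortest L (sym (take++drop≡id i u)) p = begin
  length t           ≤⟨ length-++-≤ˡ t ⟩
  length (t ++ r)    ≡⟨ cong length e ⟨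
  length (take i u)  ≡⟨ length-take i u ⟩
  i ⊓ length u       ≤⟨ m⊓n≤m i (length u) ⟩
  i                  ∎
  where open ≤-Reasoning

closureSearch-least : ∀ u k d f →
  (∀ i → i < k + d → ¬ Palindrome (drop i u)) → Palindrome (drop (k + d) u) →
  closureSearch u k (suc (d + f)) ≡ u ++ reverse (take (k + d) u)
closureSearch-least u k zero f _ found rewrite +-identityʳ k
  with isPal (u ++ reverse (take k u)) in closes
... | true  = refl
... | false with () ← trans (sym closes) (Palindrome⇒isPal (candidate-palindrome k u found))
closureSearch-least u k (suc d) f skip found rewrite +-suc k d
  with isPal (u ++ reverse (take k u)) in closes
... | true  = ⊥-elim (skip k (s≤s (m≤m+n k d)) (candidate-palindrome⁻ k u (isPal⇒Palindrome _ closes)))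
... | false = closureSearch-least u (suc k) d f skip found

rclosure-longestPalSuffix : ∀ {u t s} → LongestPalSuffix u t s → rclosure u ≡ u ++ reverse t
rclosure-longestPalSuffix {u} {t} {s} L = begin
  closureSearch u 0 (suc (length u))
    ≡⟨ cong (λ n → closureSearch u 0 (suc n)) (trans (cong length (split L)) (length-++ t)) ⟩
  closureSearch u 0 (suc (length t + length s))
    ≡⟨ closureSearch-least u 0 (length t) (length s) skip found ⟩
  u ++ reverse (take (length t) u)
    ≡⟨ cong (λ v → v ++ reverse (take (length t) v)) (split L) ⟩
  (t ++ s) ++ reverse (take (length t) (t ++ s))
    ≡⟨ cong (λ q → (t ++ s) ++ reverse q) (take-length-++ t s) ⟩
  (t ++ s) ++ reverse t
    ≡⟨ cong (_++ reverse t) (sym (split L)) ⟩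
  u ++ reverse t ∎
  where
    open ≡-Reasoning
    found : Palindrome (drop (length t) u)
    found = subst Palindrome (sym (trans (cong (drop (length t)) (split L)) (drop-length-++ t s))) (palindrome L)
    skip : ∀ i → i < length t → ¬ Palindrome (drop i u)
    skip i i<t p = <⇒≱ i<t (longestPalSuffix-minimal L i p)

-- Defining μ through this view lets a match on relative x c make μ x (c ∷ w) compute for generic x.
data Relative (x : Letter) : Letter → Set where
  same  : Relative x x
  other : Relative x (compl x)

relative : ∀ x c → Relative x c
relative a a = same
relative a b = other
relative b a = other
relative b b = same

gap : ∀ {x c} → Relative x c → Word
gap same      = []
gap {x} other = [ compl x ]

μ : Letter → Word → Word
μ x []      = []
μ x (c ∷ w) = x ∷ gap (relative x c) ++ μ x w

μ-++ : ∀ x u v → μ x (u ++ v) ≡ μ x u ++ μ x v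
μ-++ x []      v = refl
μ-++ x (c ∷ u) v = cong (x ∷_) (trans (cong (gap (relative x c) ++_) (μ-++ x u v))
                                      (sym (++-assoc (gap (relative x c)) (μ x u) (μ x v))))

μ-self : ∀ x → μ x [ x ] ≡ [ x ]
μ-self a = refl
μ-self b = refl

μ-compl∷ : ∀ x w → μ x (compl x ∷ w) ≡ x ∷ compl x ∷ μ x w
μ-compl∷ a w = refl
μ-compl∷ b w = refl

compl-≢ : ∀ x → compl x ≢ x
compl-≢ a ()
compl-≢ b ()

μ-head : ∀ x w {r} → μ x w ≢ compl x ∷ r
μ-head x (c ∷ w) e = compl-≢ x (sym (∷-injectiveˡ e))

μ∷ʳ-head : ∀ x w → ∃ λ r → μ x w ∷ʳ x ≡ x ∷ r
μ∷ʳ-head x []      = [] , refl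
μ∷ʳ-head x (c ∷ w) = _ , refl

μ-injective : ∀ x {u v} → μ x u ≡ μ x v → u ≡ v
μ-injective x {[]}    {[]}    _ = refl
μ-injective x {c ∷ u} {d ∷ v} e with relative x c | relative x d
... | same  | same  = cong (x ∷_) (μ-injective x (∷-injectiveʳ e))
... | other | other = cong (compl x ∷_) (μ-injective x (∷-injectiveʳ (∷-injectiveʳ e)))
... | same  | other = ⊥-elim (μ-head x u (∷-injectiveʳ e))
... | other | same  = ⊥-elim (μ-head x v (sym (∷-injectiveʳ e)))

μ-letter-palindrome : ∀ x c → x ∷ reverse (μ x [ c ]) ≡ μ x [ c ] ∷ʳ x
μ-letter-palindrome a a = refl
μ-letter-palindrome a b = refl
μ-letter-palindrome b a = refl
μ-letter-palindrome b b = refl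

reverse-μ∷ʳ : ∀ x w → reverse (μ x w ∷ʳ x) ≡ μ x (reverse w) ∷ʳ x
reverse-μ∷ʳ x []      = refl
reverse-μ∷ʳ x (c ∷ w) = begin
  reverse (μ x (c ∷ w) ∷ʳ x)
    ≡⟨ cong reverse (trans (cong (_∷ʳ x) (μ-++ x [ c ] w)) (++-assoc (μ x [ c ]) (μ x w) [ x ])) ⟩
  reverse (μ x [ c ] ++ μ x w ∷ʳ x)                ≡⟨ reverse-++ (μ x [ c ]) (μ x w ∷ʳ x) ⟩
  reverse (μ x w ∷ʳ x) ++ reverse (μ x [ c ])      ≡⟨ cong (_++ reverse (μ x [ c ])) (reverse-μ∷ʳ x w) ⟩
  (μ x (reverse w) ∷ʳ x) ++ reverse (μ x [ c ])    ≡⟨ ++-assoc (μ x (reverse w)) [ x ] _ ⟩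
  μ x (reverse w) ++ x ∷ reverse (μ x [ c ])       ≡⟨ cong (μ x (reverse w) ++_) (μ-letter-palindrome x c) ⟩
  μ x (reverse w) ++ μ x [ c ] ∷ʳ x                ≡⟨ ++-assoc (μ x (reverse w)) (μ x [ c ]) [ x ] ⟨
  (μ x (reverse w) ++ μ x [ c ]) ∷ʳ x              ≡⟨ cong (_∷ʳ x) (μ-++ x (reverse w) [ c ]) ⟨
  μ x (reverse w ∷ʳ c) ∷ʳ x                        ≡⟨ cong (λ q → μ x q ∷ʳ x) (unfold-reverse c w) ⟨
  μ x (reverse (c ∷ w)) ∷ʳ x                       ∎
  where open ≡-Reasoning

palindrome-μ∷ʳ : ∀ x {w} → Palindrome w → Palindrome (μ x w ∷ʳ x)
palindrome-μ∷ʳ x {w} p = trans (reverse-μ∷ʳ x w) (cong (λ q → μ x q ∷ʳ x) p)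

palindrome-μ∷ʳ⁻ : ∀ x {w} → Palindrome (μ x w ∷ʳ x) → Palindrome w
palindrome-μ∷ʳ⁻ x {w} p =
  μ-injective x (∷ʳ-injectiveˡ (μ x (reverse w)) (μ x w) (trans (sym (reverse-μ∷ʳ x w)) p))

data Cut (x : Letter) (w A B : Word) : Set where
  between : ∀ w₁ w₂ → w ≡ w₁ ++ w₂ → A ≡ μ x w₁ → B ≡ μ x w₂ → Cut x w A B
  inside  : ∀ w₁ w₂ → w ≡ w₁ ++ compl x ∷ w₂ → A ≡ μ x w₁ ∷ʳ x → B ≡ compl x ∷ μ x w₂ →
            Cut x w A B

Cut-∷ : ∀ {x w A B c} (r : Relative x c) → relative x c ≡ r →
        Cut x w A B → Cut x (c ∷ w) (x ∷ gap r ++ A) B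
Cut-∷ _ refl (between w₁ w₂ refl refl eB) = between (_ ∷ w₁) w₂ refl refl eB
Cut-∷ {x} {c = c} _ refl (inside w₁ w₂ refl refl eB) =
  inside (c ∷ w₁) w₂ refl (cong (x ∷_) (sym (++-assoc (gap (relative x c)) (μ x w₁) [ x ]))) eB

μ-cut : ∀ x w A B → μ x w ≡ A ++ B → Cut x w A B
μ-cut-∷ : ∀ {x c} w d A B (r : Relative x c) → relative x c ≡ r →
          x ∷ gap r ++ μ x w ≡ d ∷ A ++ B → Cut x (c ∷ w) (d ∷ A) B

μ-cut x w       []      B e = between [] w refl refl (sym e)
μ-cut x []      (_ ∷ _) B ()
μ-cut x (c ∷ w) (d ∷ A) B e = μ-cut-∷ w d A B (relative x c) refl e

μ-cut-∷ w d A B same rel e with refl ← ∷-injectiveˡ e =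
  Cut-∷ same rel (μ-cut _ w A B (∷-injectiveʳ e))
μ-cut-∷ w d [] B other rel e with refl ← ∷-injectiveˡ e = inside [] w refl refl (sym (∷-injectiveʳ e))
μ-cut-∷ w d (f ∷ A) B other rel e with refl ← ∷-injectiveˡ e | refl ← ∷-injectiveˡ (∷-injectiveʳ e) =
  Cut-∷ other rel (μ-cut _ w A B (∷-injectiveʳ (∷-injectiveʳ e)))

longestPalSuffix-μ∷ʳ : ∀ x {w t s} → LongestPalSuffix w t s →
                       LongestPalSuffix (μ x w ∷ʳ x) (μ x t) (μ x s ∷ʳ x)
longestPalSuffix-μ∷ʳ x {w} {t} {s} L = record
  { split      = splitμ
  ; palindrome = palindrome-μ∷ʳ x (palindrome L)
  ; shortest   = shortestμ
  }
  where
    splitμ : μ x w ∷ʳ x ≡ μ x t ++ μ x s ∷ʳ x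
    splitμ = trans (cong (λ q → μ x q ∷ʳ x) (split L))
                   (trans (cong (_∷ʳ x) (μ-++ x t s)) (++-assoc (μ x t) (μ x s) [ x ]))
    shortestμ : ∀ {t' s'} → μ x w ∷ʳ x ≡ t' ++ s' → Palindrome s' → ∃ λ r → t' ≡ μ x t ++ r
    shortestμ {t'} {s'} e p with initLast s'
    ... | [] = μ x s ∷ʳ x , trans (sym (++-identityʳ t')) (trans (sym e) splitμ)
    ... | B ∷ʳ′ z with ∷ʳ-injective (μ x w) (t' ++ B) (trans e (sym (++-assoc t' B [ z ])))
    ... | eμ , refl with μ-cut x w t' B eμ
    ... | between w₁ w₂ ew refl refl with r , refl ← shortest L {w₁} {w₂} ew (palindrome-μ∷ʳ⁻ x p) =
      μ x r , μ-++ x t r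
    ... | inside _ w₂ _ _ refl with _ , e' ← palindrome-∷ʳ (compl x ∷ μ x w₂) p =
      ⊥-elim (compl-≢ x (∷-injectiveˡ e'))

μ-∷ʳ-self : ∀ x p → μ x (p ∷ʳ x) ≡ μ x p ∷ʳ x
μ-∷ʳ-self x p = trans (μ-++ x p [ x ]) (cong (μ x p ++_) (μ-self x))

μ-∷ʳ-compl : ∀ x p → μ x (p ∷ʳ compl x) ≡ μ x p ∷ʳ x ∷ʳ compl x
μ-∷ʳ-compl x p =
  trans (μ-++ x p [ compl x ]) (trans (cong (μ x p ++_) (μ-compl∷ x [])) (sym (++-assoc (μ x p) [ x ] _)))

palindrome-compl∷μ⁻ : ∀ x {w} → Palindrome (compl x ∷ μ x w) → Palindrome (compl x ∷ w)
palindrome-compl∷μ⁻ x {w} p = palindrome-μ∷ʳ⁻ x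
  (subst (λ q → Palindrome (q ∷ʳ x)) (sym (μ-compl∷ x w)) (sandwich-palindrome [ x ] p))

longestPalSuffix-μ-compl : ∀ x {p t s σ} → LongestPalSuffix (p ∷ʳ compl x) t s → μ x s ≡ x ∷ σ →
                     LongestPalSuffix (μ x (p ∷ʳ compl x)) (μ x t ∷ʳ x) σ
longestPalSuffix-μ-compl x {p} {t} {s} {σ} L eσ = record
  { split      = splitμ
  ; palindrome = sandwich-palindrome⁻ [ x ]
                   (subst Palindrome (cong (_∷ʳ x) eσ) (palindrome-μ∷ʳ x (palindrome L)))
  ; shortest   = shortestμ
  }
  where
    y = compl x
    splitμ : μ x (p ∷ʳ y) ≡ (μ x t ∷ʳ x) ++ σ
    splitμ = begin
      μ x (p ∷ʳ y)       ≡⟨ cong (μ x) (split L) ⟩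
      μ x (t ++ s)       ≡⟨ μ-++ x t s ⟩
      μ x t ++ μ x s     ≡⟨ cong (μ x t ++_) eσ ⟩
      μ x t ++ x ∷ σ     ≡⟨ ++-assoc (μ x t) [ x ] σ ⟨
      (μ x t ∷ʳ x) ++ σ  ∎
      where open ≡-Reasoning
    shortestμ : ∀ {t' s'} → μ x (p ∷ʳ y) ≡ t' ++ s' → Palindrome s' → ∃ λ r → t' ≡ (μ x t ∷ʳ x) ++ r
    shortestμ {t'} {s'} e ps with initLast s'
    ... | [] = σ , trans (sym (++-identityʳ t')) (trans (sym e) splitμ)
    ... | B ∷ʳ′ z with refl ← ∷ʳ-injectiveʳ (μ x p ∷ʳ x) (t' ++ B)
                               (trans (sym (μ-∷ʳ-compl x p)) (trans e (sym (++-assoc t' B [ z ]))))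
                  | S , starts-y ← palindrome-∷ʳ B ps
                  with μ-cut x (p ∷ʳ y) t' (B ∷ʳ y) e
    ... | between _ w₂ _ _ eB = ⊥-elim (μ-head x w₂ (trans (sym eB) starts-y))
    ... | inside w₁ w₂ ew refl eB
      with r , refl ← shortest L {w₁} ew (palindrome-compl∷μ⁻ x (subst Palindrome eB ps))
      with r' , er' ← μ∷ʳ-head x r = r' , (begin
        μ x (t ++ r) ∷ʳ x      ≡⟨ cong (_∷ʳ x) (μ-++ x t r) ⟩
        (μ x t ++ μ x r) ∷ʳ x  ≡⟨ ++-assoc (μ x t) (μ x r) [ x ] ⟩
        μ x t ++ μ x r ∷ʳ x    ≡⟨ cong (μ x t ++_) er' ⟩
        μ x t ++ x ∷ r'        ≡⟨ ++-assoc (μ x t) [ x ] r' ⟨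
        (μ x t ∷ʳ x) ++ r'     ∎)
      where open ≡-Reasoning

longestPalSuffix-nonempty : ∀ {p z t s} → LongestPalSuffix (p ∷ʳ z) t s → ∃₂ λ c s₀ → s ≡ c ∷ s₀
longestPalSuffix-nonempty {p} {z} {t} {s} L with r , refl ← shortest L {p} {[ z ]} refl refl
  with ++-cancelˡ t s (r ∷ʳ z) (trans (sym (split L)) (++-assoc t r [ z ]))
... | refl with r
...   | []     = z , [] , refl
...   | c ∷ r' = c , r' ∷ʳ z , refl

μ-closing : ∀ x w t → μ x w ++ reverse (μ x t ∷ʳ x) ≡ μ x (w ++ reverse t) ∷ʳ x
μ-closing x w t = begin
  μ x w ++ reverse (μ x t ∷ʳ x)       ≡⟨ cong (μ x w ++_) (reverse-μ∷ʳ x t) ⟩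
  μ x w ++ μ x (reverse t) ∷ʳ x       ≡⟨ ++-assoc (μ x w) (μ x (reverse t)) [ x ] ⟨
  (μ x w ++ μ x (reverse t)) ∷ʳ x     ≡⟨ cong (_∷ʳ x) (μ-++ x w (reverse t)) ⟨
  μ x (w ++ reverse t) ∷ʳ x           ∎
  where open ≡-Reasoning

rclosure-μ∷ʳ : ∀ x w → rclosure (μ x w ∷ʳ x) ≡ μ x (rclosure w) ∷ʳ x
rclosure-μ∷ʳ x w with t , s , L ← longestPalSuffix w = begin
  rclosure (μ x w ∷ʳ x)                ≡⟨ rclosure-longestPalSuffix (longestPalSuffix-μ∷ʳ x L) ⟩
  (μ x w ∷ʳ x) ++ reverse (μ x t)      ≡⟨ ++-assoc (μ x w) [ x ] (reverse (μ x t)) ⟩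
  μ x w ++ x ∷ reverse (μ x t)         ≡⟨ cong (μ x w ++_) (reverse-++ (μ x t) [ x ]) ⟨
  μ x w ++ reverse (μ x t ∷ʳ x)        ≡⟨ μ-closing x w t ⟩
  μ x (w ++ reverse t) ∷ʳ x            ≡⟨ cong (λ q → μ x q ∷ʳ x) (rclosure-longestPalSuffix L) ⟨
  μ x (rclosure w) ∷ʳ x                ∎
  where open ≡-Reasoning

rclosure-μ-compl : ∀ x p → rclosure (μ x (p ∷ʳ compl x)) ≡ μ x (rclosure (p ∷ʳ compl x)) ∷ʳ x
rclosure-μ-compl x p with t , s , L ← longestPalSuffix (p ∷ʳ compl x)
                     with c , s₀ , refl ← longestPalSuffix-nonempty L = begin
  rclosure (μ x w)                     ≡⟨ rclosure-longestPalSuffix (longestPalSuffix-μ-compl x L refl) ⟩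
  μ x w ++ reverse (μ x t ∷ʳ x)        ≡⟨ μ-closing x w t ⟩
  μ x (w ++ reverse t) ∷ʳ x            ≡⟨ cong (λ q → μ x q ∷ʳ x) (rclosure-longestPalSuffix L) ⟨
  μ x (rclosure w) ∷ʳ x                ∎
  where
    open ≡-Reasoning
    w = p ∷ʳ compl x

rclosure-μ∷ʳ-∷ʳ : ∀ x q z → rclosure (μ x q ∷ʳ x ∷ʳ z) ≡ μ x (rclosure (q ∷ʳ z)) ∷ʳ x
rclosure-μ∷ʳ-∷ʳ x q z with relative x z
... | same  = trans (cong (λ v → rclosure (v ∷ʳ x)) (sym (μ-∷ʳ-self x q))) (rclosure-μ∷ʳ x (q ∷ʳ x))
... | other = trans (cong rclosure (sym (μ-∷ʳ-compl x q))) (rclosure-μ-compl x q)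

ψ-step : Word → Letter → Word
ψ-step p x = rclosure (p ∷ʳ x)

foldl-ψ-step-μ : ∀ x u q → foldl ψ-step (μ x q ∷ʳ x) u ≡ μ x (foldl ψ-step q u) ∷ʳ x
foldl-ψ-step-μ x []      q = refl
foldl-ψ-step-μ x (z ∷ u) q =
  trans (cong (λ v → foldl ψ-step v u) (rclosure-μ∷ʳ-∷ʳ x q z)) (foldl-ψ-step-μ x u (ψ-step q z))

rclosure-[x] : ∀ x → rclosure [ x ] ≡ [ x ]
rclosure-[x] a = refl
rclosure-[x] b = refl

ψ-∷ : ∀ x u → ψ (x ∷ u) ≡ μ x (ψ u) ∷ʳ x
ψ-∷ x u = trans (cong (λ v → foldl ψ-step v u) (rclosure-[x] x)) (foldl-ψ-step-μ x u [])

φ-++ : ∀ k u v → φ k (u ++ v) ≡ φ k u ++ φ k v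
φ-++ k []      v = refl
φ-++ k (a ∷ u) v =
  trans (cong (λ q → rep (suc k) a ++ b ∷ q) (φ-++ k u v)) (sym (++-assoc (rep (suc k) a) _ (φ k v)))
φ-++ k (b ∷ u) v =
  trans (cong (λ q → rep k a ++ b ∷ q) (φ-++ k u v)) (sym (++-assoc (rep k a) _ (φ k v)))

φ̂-++ : ∀ k u v → φ̂ k (u ++ v) ≡ φ̂ k u ++ φ̂ k v
φ̂-++ k []      v = refl
φ̂-++ k (a ∷ u) v =
  cong (a ∷_) (trans (cong (rep k b ++_) (φ̂-++ k u v)) (sym (++-assoc (rep k b) _ (φ̂ k v))))
φ̂-++ k (b ∷ u) v =
  cong (a ∷_) (trans (cong (rep (suc k) b ++_) (φ̂-++ k u v)) (sym (++-assoc (rep (suc k) b) _ (φ̂ k v))))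

μa≗φ̂₀ : ∀ w → μ a w ≡ φ̂ 0 w
μa≗φ̂₀ []      = refl
μa≗φ̂₀ (a ∷ w) = cong (a ∷_) (μa≗φ̂₀ w)
μa≗φ̂₀ (b ∷ w) = cong (λ q → a ∷ b ∷ q) (μa≗φ̂₀ w)

μb∷ʳb : ∀ w → μ b w ∷ʳ b ≡ b ∷ φ 0 w
μb∷ʳb []      = refl
μb∷ʳb (a ∷ w) = cong (λ q → b ∷ a ∷ q) (μb∷ʳb w)
μb∷ʳb (b ∷ w) = cong (b ∷_) (μb∷ʳb w)

christoffel-a∷ : ∀ v → christoffel (a ∷ v) ≡ φ̂ 0 (christoffel v)
christoffel-a∷ v = cong (a ∷_) (begin
  ψ (a ∷ v) ++ [ b ]            ≡⟨ cong (_++ [ b ]) (ψ-∷ a v) ⟩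
  μ a (ψ v) ∷ʳ a ++ [ b ]       ≡⟨ ++-assoc (μ a (ψ v)) [ a ] [ b ] ⟩
  μ a (ψ v) ++ φ̂ 0 [ b ]        ≡⟨ cong (_++ φ̂ 0 [ b ]) (μa≗φ̂₀ (ψ v)) ⟩
  φ̂ 0 (ψ v) ++ φ̂ 0 [ b ]        ≡⟨ φ̂-++ 0 (ψ v) [ b ] ⟨
  φ̂ 0 (ψ v ++ [ b ])            ∎)
  where open ≡-Reasoning

christoffel-b∷ : ∀ v → christoffel (b ∷ v) ≡ φ 0 (christoffel v)
christoffel-b∷ v = cong (a ∷_) (begin
  ψ (b ∷ v) ++ [ b ]            ≡⟨ cong (_++ [ b ]) (ψ-∷ b v) ⟩
  μ b (ψ v) ∷ʳ b ++ [ b ]       ≡⟨ cong (_++ [ b ]) (μb∷ʳb (ψ v)) ⟩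
  b ∷ φ 0 (ψ v) ++ φ 0 [ b ]    ≡⟨ cong (b ∷_) (φ-++ 0 (ψ v) [ b ]) ⟨
  b ∷ φ 0 (ψ v ++ [ b ])        ∎)
  where open ≡-Reasoning

φ̂₀-aᵏb : ∀ n r → φ̂ 0 (rep n a ++ b ∷ r) ≡ rep (suc n) a ++ b ∷ φ̂ 0 r
φ̂₀-aᵏb zero    r = refl
φ̂₀-aᵏb (suc n) r = cong (a ∷_) (φ̂₀-aᵏb n r)

φ₀-bᵏ : ∀ n r → φ 0 (rep n b ++ r) ≡ rep n b ++ φ 0 r
φ₀-bᵏ zero    r = refl
φ₀-bᵏ (suc n) r = cong (b ∷_) (φ₀-bᵏ n r)

φ-suc : ∀ k w → φ (suc k) w ≡ φ̂ 0 (φ k w)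
φ-suc k []      = refl
φ-suc k (a ∷ w) =
  trans (cong (λ q → rep (suc (suc k)) a ++ b ∷ q) (φ-suc k w)) (sym (φ̂₀-aᵏb (suc k) (φ k w)))
φ-suc k (b ∷ w) = trans (cong (λ q → rep (suc k) a ++ b ∷ q) (φ-suc k w)) (sym (φ̂₀-aᵏb k (φ k w)))

φ̂-suc : ∀ k w → φ̂ (suc k) w ≡ φ 0 (φ̂ k w)
φ̂-suc k []      = refl
φ̂-suc k (a ∷ w) = cong (λ q → a ∷ b ∷ q) (trans (cong (rep k b ++_) (φ̂-suc k w)) (sym (φ₀-bᵏ k (φ̂ k w))))
φ̂-suc k (b ∷ w) =
  cong (λ q → a ∷ b ∷ b ∷ q) (trans (cong (rep k b ++_) (φ̂-suc k w)) (sym (φ₀-bᵏ k (φ̂ k w))))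

christoffel-aᵏb : ∀ k u → christoffel (rep k a ++ b ∷ u) ≡ φ k (christoffel u)
christoffel-aᵏb zero    u = christoffel-b∷ u
christoffel-aᵏb (suc k) u = begin
  christoffel (a ∷ rep k a ++ b ∷ u)          ≡⟨ christoffel-a∷ (rep k a ++ b ∷ u) ⟩
  φ̂ 0 (christoffel (rep k a ++ b ∷ u))        ≡⟨ cong (φ̂ 0) (christoffel-aᵏb k u) ⟩
  φ̂ 0 (φ k (christoffel u))                   ≡⟨ φ-suc k (christoffel u) ⟨
  φ (suc k) (christoffel u)                   ∎
  where open ≡-Reasoning

christoffel-bᵏa : ∀ k u → christoffel (rep k b ++ a ∷ u) ≡ φ̂ k (christoffel u)
christoffel-bᵏa zero    u = christoffel-a∷ u
christoffel-bᵏa (suc k) u = begin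
  christoffel (b ∷ rep k b ++ a ∷ u)          ≡⟨ christoffel-b∷ (rep k b ++ a ∷ u) ⟩
  φ 0 (christoffel (rep k b ++ a ∷ u))        ≡⟨ cong (φ 0) (christoffel-bᵏa k u) ⟩
  φ 0 (φ̂ k (christoffel u))                   ≡⟨ φ̂-suc k (christoffel u) ⟨
  φ̂ (suc k) (christoffel u)                   ∎
  where open ≡-Reasoning

≡ᵇ-refl : ∀ n → (n ≡ᵇ n) ≡ true
≡ᵇ-refl zero    = refl
≡ᵇ-refl (suc n) = ≡ᵇ-refl n

n≡ᵇ1+n : ∀ n → (n ≡ᵇ suc n) ≡ false
n≡ᵇ1+n zero    = refl
n≡ᵇ1+n (suc n) = n≡ᵇ1+n n

1+n≡ᵇn : ∀ n → (suc n ≡ᵇ n) ≡ false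
1+n≡ᵇn zero    = refl
1+n≡ᵇn (suc n) = 1+n≡ᵇn n

-- decφ-go splits on its counter first, so even these steps need a case split on n.
decφ-go-a : ∀ k n w → decφ-go k n (a ∷ w) ≡ decφ-go k (suc n) w
decφ-go-a k zero    w = refl
decφ-go-a k (suc n) w = refl

decφ-go-b : ∀ k n w → decφ-go k n (b ∷ w) ≡
  (if n ≡ᵇ suc k then Maybe.map (a ∷_) (decφ-go k 0 w)
   else if n ≡ᵇ k then Maybe.map (b ∷_) (decφ-go k 0 w) else nothing)
decφ-go-b k zero    w = refl
decφ-go-b k (suc n) w = refl

decφ-go-aᵐ : ∀ k m n r → decφ-go k n (rep m a ++ r) ≡ decφ-go k (m + n) r
decφ-go-aᵐ k zero    n r = refl
decφ-go-aᵐ k (suc m) n r =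
  trans (decφ-go-a k n (rep m a ++ r)) (trans (decφ-go-aᵐ k m (suc n) r) (cong (λ i → decφ-go k i r) (+-suc m n)))

φ⁻¹-φ : ∀ k w → φ⁻¹ k (φ k w) ≡ just w
φ⁻¹-φ k []      = refl
φ⁻¹-φ k (a ∷ w)
  rewrite decφ-go-aᵐ k (suc k) 0 (b ∷ φ k w) | +-identityʳ k | ≡ᵇ-refl k | φ⁻¹-φ k w = refl
φ⁻¹-φ k (b ∷ w)
  rewrite decφ-go-aᵐ k k 0 (b ∷ φ k w) | +-identityʳ k | decφ-go-b k k (φ k w) | n≡ᵇ1+n k | ≡ᵇ-refl k
        | φ⁻¹-φ k w = refl

decφ̂-go-bᵐ : ∀ k j m r → decφ̂-go k (just m) (rep j b ++ r) ≡ decφ̂-go k (just (j + m)) r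
decφ̂-go-bᵐ k zero    m r = refl
decφ̂-go-bᵐ k (suc j) m r = trans (decφ̂-go-bᵐ k j (suc m) r) (cong (λ i → decφ̂-go k (just i) r) (+-suc j m))

-- φ̂ₖ-images begin at a codeword boundary, where the pending codeword a bᵐ is emitted.
decφ̂-go-boundary : ∀ k m w → decφ̂-go k (just m) (φ̂ k w) ≡ emitφ̂ k m (φ̂⁻¹ k (φ̂ k w))
decφ̂-go-boundary k m []      = refl
decφ̂-go-boundary k m (a ∷ w) = refl
decφ̂-go-boundary k m (b ∷ w) = refl

φ̂⁻¹-φ̂ : ∀ k w → φ̂⁻¹ k (φ̂ k w) ≡ just w
φ̂⁻¹-φ̂ k []      = refl
φ̂⁻¹-φ̂ k (a ∷ w)
  rewrite decφ̂-go-bᵐ k k 0 (φ̂ k w) | +-identityʳ k | decφ̂-go-boundary k k w | φ̂⁻¹-φ̂ k w | ≡ᵇ-refl k = refl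
φ̂⁻¹-φ̂ k (b ∷ w)
  rewrite decφ̂-go-bᵐ k (suc k) 0 (φ̂ k w) | +-identityʳ k | decφ̂-go-boundary k (suc k) w | φ̂⁻¹-φ̂ k w
        | 1+n≡ᵇn k | ≡ᵇ-refl k = refl

data LeadingRun : Word → Set where
  leadingRun : ∀ x m u → LeadingRun (rep (suc m) x ++ compl x ∷ u)

run-decomposition : ∀ x u → compl x ∈ u → ∃₂ λ m u' → u ≡ rep m x ++ compl x ∷ u'
run-decomposition x (c ∷ u) (here refl) = 0 , u , refl
run-decomposition x (c ∷ u) (there q) with relative x c
... | same with m , u' , refl ← run-decomposition x u q = suc m , u' , refl
... | other = 0 , u , refl

nonConstant⇒leadingRun : ∀ {v} → NonConstant v → LeadingRun v
nonConstant⇒leadingRun {a ∷ u} (_ , there b∈u) with m , u' , refl ← run-decomposition a u b∈u =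
  leadingRun a m u'
nonConstant⇒leadingRun {b ∷ u} (there a∈u , _) with m , u' , refl ← run-decomposition b u a∈u =
  leadingRun b m u'

index-leadingRun : ∀ x m u → index (rep (suc m) x ++ compl x ∷ u) ≡ suc m
index-leadingRun a zero    u = refl
index-leadingRun a (suc m) u = cong suc (index-leadingRun a m u)
index-leadingRun b zero    u = refl
index-leadingRun b (suc m) u = cong suc (index-leadingRun b m u)

₊-leadingRun : ∀ x m u → ₊ (rep (suc m) x ++ compl x ∷ u) ≡ u
₊-leadingRun a zero    u = refl
₊-leadingRun a (suc m) u = ₊-leadingRun a m u
₊-leadingRun b zero    u = refl
₊-leadingRun b (suc m) u = ₊-leadingRun b m u

mainTheorem2 : (v : Word) → NonConstant v → ∂ v ≡ just (christoffel (₊ v))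
mainTheorem2 v nc with nonConstant⇒leadingRun nc
... | leadingRun a m u = begin
  φ⁻¹ (index v) (christoffel v)            ≡⟨ cong₂ φ⁻¹ (index-leadingRun a m u) (christoffel-aᵏb (suc m) u) ⟩
  φ⁻¹ (suc m) (φ (suc m) (christoffel u))  ≡⟨ φ⁻¹-φ (suc m) (christoffel u) ⟩
  just (christoffel u)                     ≡⟨ cong (just ∘ christoffel) (₊-leadingRun a m u) ⟨
  just (christoffel (₊ v))                 ∎
  where open ≡-Reasoning
... | leadingRun b m u = begin
  φ̂⁻¹ (index v) (christoffel v)            ≡⟨ cong₂ φ̂⁻¹ (index-leadingRun b m u) (christoffel-bᵏa (suc m) u) ⟩
  φ̂⁻¹ (suc m) (φ̂ (suc m) (christoffel u))  ≡⟨ φ̂⁻¹-φ̂ (suc m) (christoffel u) ⟩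
  just (christoffel u)                     ≡⟨ cong (just ∘ christoffel) (₊-leadingRun b m u) ⟨
  just (christoffel (₊ v))                 ∎
  where open ≡-Reasoning
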